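{- Let $A$ be a finite $0/1$-word containing at least one $1$, and let $A^R$ be its reversal. Then $S(A)\equiv 2 \pmod 3$ if and only if $S(A^R)\equiv 2\pmod 3$, where $S$ denotes the parity sum.
   Context: For a finite word $A$ over $\{0,1\}$ containing at least one $1$, write $A = 1^{h_0}0^{t_1}1^{h_1}0^{t_2}\cdots 1^{h_{n-1}}0^{t_n}1^{h_n}$ with $n\ge 1$ and non-negative integers $h_0,\dots,h_n,t_1,\dots,t_n$ (here $x^k$ denotes $k$ consecutive copies of $x$, and $x^0$ is empty; such a decomposition is not unique). Put $p_i=(t_1+\dots+t_i)\bmod 2\in\{0,1\}$ for $1\le i\le n$, and define the parity sum $S(A)=h_0+\sum_{i=1}^n(-1)^{p_i}h_i-p_n$. The value of $S(A)$ does not depend on the chosen decomposition. -}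

module Defs where

open import Data.Bool using (Bool; true; false)
open import Data.Nat using (ℕ; zero; suc; _%_)
import Data.Nat as ℕ
open import Data.Integer using (ℤ; +_; -_; _+_)
open import Data.List using (List; []; _∷_; _++_; replicate; concatMap)
open import Data.Product using (_×_; _,_)
open import Relation.Binary.PropositionalEquality using (_≡_)

-- A 0/1-word: the letter 1 is 'true', the letter 0 is 'false'.
Word : Set
Word = List Bool

-- A decomposition A = 1^{h0} 0^{t1} 1^{h1} ... 0^{tn} 1^{hn}, n ≥ 1.
-- 'first' is (t1 , h1), 'rest' is the list ((t2,h2), ..., (tn,hn)).
record Decomp : Set where
  constructor decomp
  field
    h0    : ℕ
    first : ℕ × ℕ
    rest  : List (ℕ × ℕ)

block : ℕ × ℕ → Word
block (t , h) = replicate t false ++ replicate h true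

word : Decomp → Word
word (decomp h0 b bs) = replicate h0 true ++ concatMap block (b ∷ bs)

signed : ℕ → ℕ → ℤ
signed zero h = + h
signed (suc _) h = - (+ h)

-- psum p blocks : given the parity p = p_{i-1} accumulated so far,
-- returns  Σ_{j ≥ i} (-1)^{p_j} h_j  - p_n.
psum : ℕ → List (ℕ × ℕ) → ℤ
psum p [] = - (+ p)
psum p ((t , h) ∷ bs) = signed p' h + psum p' bs
  where p' = (p ℕ.+ t) % 2

-- Parity sum of a decomposition: h0 + Σ_{i=1}^n (-1)^{p_i} h_i - p_n.
S : Decomp → ℤ
S (decomp h0 b bs) = + h0 + psum 0 (b ∷ bs)

_decomposes_ : Decomp → Word → Set
D decomposes A = word D ≡ A

{-# OPTIONS --safe #-}
-- Write S(A) = T(A) − π(A), where π(A) is the parity of the number of 0s of A and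
-- T(A) sums (−1)^(number of 0s before it) over the 1s of A.  A 1 preceded by k zeros
-- in A is preceded by π(A) − k zeros (mod 2) in Aᴿ, so T(Aᴿ) = (−1)^π(A) T(A) and
-- π(Aᴿ) = π(A).  If π(A) = 0 then S(Aᴿ) = S(A); if π(A) = 1 then S(A) = T − 1 and
-- S(Aᴿ) = −T − 1, and each is ≡ 2 (mod 3) exactly when 3 ∣ T.
module Submission where

open import Defs
open import Data.Bool using (Bool; true; false; not; _xor_)
open import Data.Bool.Properties using (not-involutive; not-distribˡ-xor; xor-assoc; xor-comm)
open import Data.Nat using (ℕ; zero; suc; _%_)
import Data.Nat as ℕ
open import Data.Integer using (ℤ; +_; -_; _+_; _-_; _*_)
open import Data.Integer.Properties using (+-identityˡ; +-assoc; *-identityˡ; neg-distrib-+; neg-distribˡ-*; -1*i≡-i)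
open import Data.Integer.Divisibility using (_∣_; divides)
import Data.Integer.Divisibility.Signed as Signed
open import Data.Integer.Tactic.RingSolver using (solve-∀)
open import Data.List using ([]; _∷_; _++_; [_]; reverse; replicate; concatMap)
open import Data.List.Properties using (unfold-reverse)
open import Data.List.Membership.Propositional using (_∈_)
open import Data.Product using (_,_)
open import Function.Bundles using (_⇔_; mk⇔)
open import Function.Construct.Identity using (⇔-id)
open import Relation.Binary.PropositionalEquality using (_≡_; refl; sym; trans; cong; cong₂; subst; module ≡-Reasoning)

bit : Bool → ℕ
bit false = 0
bit true  = 1

sign : Bool → ℤ
sign false = + 1
sign true  = - (+ 1)

sign-not : ∀ b → sign (not b) ≡ - sign b
sign-not false = refl
sign-not true  = refl

sign-xor : ∀ b c → sign (b xor c) ≡ sign b * sign c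
sign-xor false c = sym (*-identityˡ (sign c))
sign-xor true  false = refl
sign-xor true  true  = refl

signed-bit : ∀ b h → signed (bit b) h ≡ sign b * + h
signed-bit false h = sym (*-identityˡ (+ h))
signed-bit true  h = sym (-1*i≡-i (+ h))

parity : Word → Bool
parity []          = false
parity (true  ∷ w) = parity w
parity (false ∷ w) = not (parity w)

signedOnes : Word → ℤ
signedOnes []          = + 0
signedOnes (true  ∷ w) = + 1 + signedOnes w
signedOnes (false ∷ w) = - signedOnes w

paritySum : Word → ℤ
paritySum w = signedOnes w - + bit (parity w)

parity-++ : ∀ u v → parity (u ++ v) ≡ parity u xor parity v
parity-++ []          v = refl
parity-++ (true  ∷ u) v = parity-++ u v
parity-++ (false ∷ u) v = trans (cong not (parity-++ u v)) (not-distribˡ-xor (parity u) (parity v))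

signedOnes-++ : ∀ u v → signedOnes (u ++ v) ≡ signedOnes u + sign (parity u) * signedOnes v
signedOnes-++ [] v = sym (trans (+-identityˡ _) (*-identityˡ (signedOnes v)))
signedOnes-++ (true ∷ u) v =
  trans (cong (_+_ (+ 1)) (signedOnes-++ u v)) (sym (+-assoc (+ 1) (signedOnes u) _))
signedOnes-++ (false ∷ u) v = begin
  - signedOnes (u ++ v)                                       ≡⟨ cong -_ (signedOnes-++ u v) ⟩
  - (signedOnes u + sign (parity u) * signedOnes v)           ≡⟨ neg-distrib-+ (signedOnes u) _ ⟩
  - signedOnes u + - (sign (parity u) * signedOnes v)         ≡⟨ cong (_+_ (- signedOnes u)) (neg-distribˡ-* (sign (parity u)) _) ⟩
  - signedOnes u + - sign (parity u) * signedOnes v           ≡⟨ cong (λ s → - signedOnes u + s * signedOnes v) (sign-not (parity u)) ⟨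
  - signedOnes u + sign (not (parity u)) * signedOnes v       ∎
  where open ≡-Reasoning

parity-reverse : ∀ w → parity (reverse w) ≡ parity w
parity-reverse []      = refl
parity-reverse (x ∷ w) = begin
  parity (reverse (x ∷ w))          ≡⟨ cong parity (unfold-reverse x w) ⟩
  parity (reverse w ++ [ x ])       ≡⟨ parity-++ (reverse w) [ x ] ⟩
  parity (reverse w) xor parity [ x ] ≡⟨ cong (_xor parity [ x ]) (parity-reverse w) ⟩
  parity w xor parity [ x ]         ≡⟨ xor-comm (parity w) (parity [ x ]) ⟩
  parity [ x ] xor parity w         ≡⟨ parity-++ [ x ] w ⟨
  parity (x ∷ w)                    ∎
  where open ≡-Reasoning

signedOnes-reverse : ∀ w → signedOnes (reverse w) ≡ sign (parity w) * signedOnes w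
signedOnes-reverse []      = refl
signedOnes-reverse (x ∷ w) = begin
  signedOnes (reverse (x ∷ w))    ≡⟨ cong signedOnes (unfold-reverse x w) ⟩
  signedOnes (reverse w ++ [ x ]) ≡⟨ signedOnes-++ (reverse w) [ x ] ⟩
  signedOnes (reverse w) + sign (parity (reverse w)) * signedOnes [ x ]
    ≡⟨ cong₂ (λ a p → a + sign p * signedOnes [ x ]) (signedOnes-reverse w) (parity-reverse w) ⟩
  sign (parity w) * signedOnes w + sign (parity w) * signedOnes [ x ] ≡⟨ append-letter x ⟩
  sign (parity (x ∷ w)) * signedOnes (x ∷ w) ∎
  where
  open ≡-Reasoning
  append-letter : ∀ x → sign (parity w) * signedOnes w + sign (parity w) * signedOnes [ x ]
             ≡ sign (parity (x ∷ w)) * signedOnes (x ∷ w)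
  append-letter true  = add-one (sign (parity w)) (signedOnes w)
    where add-one : ∀ s t → s * t + s * + 1 ≡ s * (+ 1 + t)
          add-one = solve-∀
  append-letter false rewrite sign-not (parity w) = add-zero (sign (parity w)) (signedOnes w)
    where add-zero : ∀ s t → s * t + s * + 0 ≡ - s * - t
          add-zero = solve-∀

signedOnes-ones : ∀ h → signedOnes (replicate h true) ≡ + h
signedOnes-ones zero    = refl
signedOnes-ones (suc h) = cong (_+_ (+ 1)) (signedOnes-ones h)

parity-ones : ∀ h → parity (replicate h true) ≡ false
parity-ones zero    = refl
parity-ones (suc h) = parity-ones h

signedOnes-block : ∀ t h → signedOnes (block (t , h)) ≡ sign (parity (replicate t false)) * + h
signedOnes-block zero    h = trans (signedOnes-ones h) (sym (*-identityˡ (+ h)))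
signedOnes-block (suc t) h = begin
  - signedOnes (block (t , h))                       ≡⟨ cong -_ (signedOnes-block t h) ⟩
  - (sign z * + h)                                   ≡⟨ neg-distribˡ-* (sign z) (+ h) ⟩
  - sign z * + h                                     ≡⟨ cong (_* + h) (sign-not z) ⟨
  sign (not z) * + h                                 ∎
  where
  open ≡-Reasoning
  z = parity (replicate t false)

parity-block : ∀ t h → parity (block (t , h)) ≡ parity (replicate t false)
parity-block zero    h = parity-ones h
parity-block (suc t) h = cong not (parity-block t h)

bit-xor-zeros : ∀ b t → (bit b ℕ.+ t) % 2 ≡ bit (b xor parity (replicate t false))
bit-xor-zeros false zero    = refl
bit-xor-zeros true  zero    = refl
bit-xor-zeros false (suc t) = bit-xor-zeros true t
bit-xor-zeros true  (suc t) =
  trans (bit-xor-zeros false t) (cong bit (sym (not-involutive (parity (replicate t false)))))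

psum-blocks : ∀ b bs → let w = concatMap block bs in
              psum (bit b) bs ≡ sign b * signedOnes w - + bit (b xor parity w)
psum-blocks false []            = refl
psum-blocks true  []            = refl
psum-blocks b     ((t , h) ∷ bs) = begin
  signed ((bit b ℕ.+ t) % 2) h + psum ((bit b ℕ.+ t) % 2) bs
    ≡⟨ cong (λ p → signed p h + psum p bs) (bit-xor-zeros b t) ⟩
  signed (bit c) h + psum (bit c) bs
    ≡⟨ cong₂ _+_ (signed-bit c h) (psum-blocks c bs) ⟩
  sign c * + h + (sign c * signedOnes w - + bit (c xor parity w))
    ≡⟨ +-assoc (sign c * + h) _ _ ⟨
  sign c * + h + sign c * signedOnes w - + bit (c xor parity w)
    ≡⟨ cong₂ (λ x p → x - + bit p) signedOnes-step parity-step ⟩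
  sign b * signedOnes (block (t , h) ++ w) - + bit (b xor parity (block (t , h) ++ w)) ∎
  where
  open ≡-Reasoning
  w = concatMap block bs
  z = parity (replicate t false)
  c = b xor z
  signedOnes-step : sign c * + h + sign c * signedOnes w ≡ sign b * signedOnes (block (t , h) ++ w)
  signedOnes-step = begin
    sign c * + h + sign c * signedOnes w
      ≡⟨ cong (λ s → s * + h + s * signedOnes w) (sign-xor b z) ⟩
    sign b * sign z * + h + sign b * sign z * signedOnes w
      ≡⟨ regroup (sign b) (sign z) (+ h) (signedOnes w) ⟩
    sign b * (sign z * + h + sign z * signedOnes w)
      ≡⟨ cong₂ (λ x p → sign b * (x + sign p * signedOnes w)) (signedOnes-block t h) (parity-block t h) ⟨
    sign b * (signedOnes (block (t , h)) + sign (parity (block (t , h))) * signedOnes w)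
      ≡⟨ cong (sign b *_) (signedOnes-++ (block (t , h)) w) ⟨
    sign b * signedOnes (block (t , h) ++ w) ∎
    where regroup : ∀ a b x y → a * b * x + a * b * y ≡ a * (b * x + b * y)
          regroup = solve-∀
  parity-step : c xor parity w ≡ b xor parity (block (t , h) ++ w)
  parity-step = begin
    (b xor z) xor parity w                          ≡⟨ xor-assoc b z (parity w) ⟩
    b xor (z xor parity w)                          ≡⟨ cong (λ p → b xor (p xor parity w)) (parity-block t h) ⟨
    b xor (parity (block (t , h)) xor parity w)     ≡⟨ cong (b xor_) (parity-++ (block (t , h)) w) ⟨
    b xor parity (block (t , h) ++ w)               ∎

S≡paritySum-word : ∀ D → S D ≡ paritySum (word D)
S≡paritySum-word (decomp h0 b bs) = begin
  + h0 + psum 0 (b ∷ bs)                                  ≡⟨ cong (_+_ (+ h0)) (psum-blocks false (b ∷ bs)) ⟩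
  + h0 + (sign false * signedOnes w - + bit (parity w))   ≡⟨ +-assoc (+ h0) (sign false * signedOnes w) _ ⟨
  + h0 + sign false * signedOnes w - + bit (parity w)     ≡⟨ cong₂ (λ x p → x - + bit p) signedOnes-step parity-step ⟨
  paritySum (replicate h0 true ++ w)                      ∎
  where
  open ≡-Reasoning
  w = concatMap block (b ∷ bs)
  signedOnes-step : signedOnes (replicate h0 true ++ w) ≡ + h0 + sign false * signedOnes w
  signedOnes-step = trans (signedOnes-++ (replicate h0 true) w)
    (cong₂ (λ x p → x + sign p * signedOnes w) (signedOnes-ones h0) (parity-ones h0))
  parity-step : parity (replicate h0 true ++ w) ≡ parity w
  parity-step = trans (parity-++ (replicate h0 true) w) (cong (_xor parity w) (parity-ones h0))

paritySum-reverse : ∀ w → paritySum (reverse w) ≡ sign (parity w) * signedOnes w - + bit (parity w)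
paritySum-reverse w = cong₂ (λ x p → x - + bit p) (signedOnes-reverse w) (parity-reverse w)

∣m+n⇒[∣m⇔∣n] : ∀ i m n → i ∣ m + n → (i ∣ m ⇔ i ∣ n)
∣m+n⇒[∣m⇔∣n] i m n i∣m+n = mk⇔
  (λ i∣m → ∣⇒∣ᵤ (∣m+n∣m⇒∣n {i} {m} {n} i∣m+nˢ (∣ᵤ⇒∣ {i} {m} i∣m)))
  (λ i∣n → ∣⇒∣ᵤ (∣m+n∣n⇒∣m {i} {m} {n} i∣m+nˢ (∣ᵤ⇒∣ {i} {n} i∣n)))
  where
  open Signed using (∣ᵤ⇒∣; ∣⇒∣ᵤ; ∣m+n∣m⇒∣n; ∣m+n∣n⇒∣m)
  i∣m+nˢ : i Signed.∣ m + n
  i∣m+nˢ = ∣ᵤ⇒∣ {i} {m + n} i∣m+n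

sign-≡2-mod3 : ∀ b x → (+ 3 ∣ x - + bit b - + 2) ⇔ (+ 3 ∣ sign b * x - + bit b - + 2)
sign-≡2-mod3 false x rewrite *-identityˡ x = ⇔-id _
sign-≡2-mod3 true  x rewrite -1*i≡-i x =
  ∣m+n⇒[∣m⇔∣n] (+ 3) (x - + 1 - + 2) (- x - + 1 - + 2) (subst (+ 3 ∣_) (sym (sum≡-6 x)) (divides 2 refl))
  where
  sum≡-6 : ∀ x → x - + 1 - + 2 + (- x - + 1 - + 2) ≡ - + 6
  sum≡-6 = solve-∀

paritySum-≡2-mod3-reverse : ∀ w → (+ 3 ∣ paritySum w - + 2) ⇔ (+ 3 ∣ paritySum (reverse w) - + 2)
paritySum-≡2-mod3-reverse w rewrite paritySum-reverse w = sign-≡2-mod3 (parity w) (signedOnes w)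

lemma1 : (A : Word) → true ∈ A → (D : Decomp) → D decomposes A → (E : Decomp) → E decomposes (reverse A) → ((+ 3) ∣ (S D - + 2)) ⇔ ((+ 3) ∣ (S E - + 2))
lemma1 A _ D D↦A E E↦Aᴿ rewrite S≡paritySum-word D | S≡paritySum-word E | D↦A | E↦Aᴿ =
  paritySum-≡2-mod3-reverse A
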